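{- Let $t_1,t_2,u$ be positive integers such that $t_1,t_2\leq u/3$. Then the number of antichains in the poset $[t_1]\times[t_2]$ is at most $4^u$. Moreover, if $\beta\in[0,1/3]$, then the number of antichains of size $\beta u$ in $[t_1]\times[t_2]$ is at most $\exp_2(4\log_2(1/\beta)\,\beta u)$.
   Context: For a positive integer $s$, $[s]=\{0,1,\dots,s-1\}$. The poset $[t_1]\times[t_2]$ has the order $(a,b)\preceq(a',b')$ iff $a\leq a'$ and $b\leq b'$. An antichain is a set of pairwise incomparable elements. $\exp_2(x)=2^x$. -}

module Defs where

open import Data.Nat using (ℕ; zero; suc; _+_)
open import Data.Bool using (Bool; true; false; T)
open import Data.Fin using (Fin; _≤_)
open import Data.Fin.Properties using (_≤?_; all?) renaming (_≟_ to _≟ᶠ_)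
open import Data.Product using (_×_; _,_)
open import Data.Product.Properties using (≡-dec)
open import Data.Vec using (Vec; []; _∷_; lookup)
open import Data.List using (List; []; _∷_; _++_; map; concatMap; filter; length)
open import Relation.Binary.PropositionalEquality using (_≡_)
open import Relation.Nullary using (Dec; yes; no)
open import Relation.Nullary.Decidable using (_×-dec_; _→-dec_)
open import Data.Bool.Properties using (T?)

Point : ℕ → ℕ → Set
Point t₁ t₂ = Fin t₁ × Fin t₂

_≼_ : ∀ {t₁ t₂} → Point t₁ t₂ → Point t₁ t₂ → Set
(a , b) ≼ (a' , b') = (a ≤ a') × (b ≤ b')

-- A subset of [t₁] × [t₂], given by its t₁ × t₂ indicator matrix
PSubset : ℕ → ℕ → Set
PSubset t₁ t₂ = Vec (Vec Bool t₂) t₁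

_∈ₚ_ : ∀ {t₁ t₂} → Point t₁ t₂ → PSubset t₁ t₂ → Set
(a , b) ∈ₚ S = T (lookup (lookup S a) b)

IsAntichain : ∀ {t₁ t₂} → PSubset t₁ t₂ → Set
IsAntichain {t₁} {t₂} S =
  (p q : Point t₁ t₂) → p ∈ₚ S → q ∈ₚ S → p ≼ q → p ≡ q

isAntichain? : ∀ {t₁ t₂} (S : PSubset t₁ t₂) → Dec (IsAntichain S)
isAntichain? {t₁} {t₂} S with (all? λ a → all? λ b → all? λ a' → all? λ b' →
    T? (lookup (lookup S a) b) →-dec (T? (lookup (lookup S a') b') →-dec
      (((a ≤? a') ×-dec (b ≤? b')) →-dec ≡-dec _≟ᶠ_ _≟ᶠ_ (a , b) (a' , b'))))
... | yes h = yes λ { (a , b) (a' , b') m m' le → h a b a' b' m m' le }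
... | no ¬h = no λ h → ¬h λ a b a' b' m m' le → h (a , b) (a' , b') m m' le

countRow : ∀ {n} → Vec Bool n → ℕ
countRow [] = 0
countRow (true ∷ v) = suc (countRow v)
countRow (false ∷ v) = countRow v

size : ∀ {t₁ t₂} → PSubset t₁ t₂ → ℕ
size [] = 0
size (r ∷ S) = countRow r + size S

allVecs : ∀ {A : Set} → List A → (n : ℕ) → List (Vec A n)
allVecs xs zero = [] ∷ []
allVecs xs (suc n) = concatMap (λ x → map (x ∷_) (allVecs xs n)) xs

allPSubsets : (t₁ t₂ : ℕ) → List (PSubset t₁ t₂)
allPSubsets t₁ t₂ = allVecs (allVecs (true ∷ false ∷ []) t₂) t₁

numAntichains : ℕ → ℕ → ℕ
numAntichains t₁ t₂ = length (filter isAntichain? (allPSubsets t₁ t₂))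

numAntichainsOfSize : ℕ → ℕ → ℕ → ℕ
numAntichainsOfSize t₁ t₂ k =
  length (filter (λ S → isAntichain? S ×-dec (size S Data.Nat.≟ k)) (allPSubsets t₁ t₂))

-- Write a(t, c) for the number of antichains of [t] × [c]. The first row of an
-- antichain contains at most one point, and if that point lies in column b then
-- every other point lies in a column < b. Classifying antichains by their first
-- row therefore gives a(t + 1, c) ≤ a(t, c) + Σ_{b<c} a(t, b), whence
-- a(t, c) ≤ 2^(t+c) ≤ 4^u. Keeping track of the size k, the same recursion and
-- the hockey-stick identity bound the number of antichains of size k by
-- C(t₁,k)·C(t₂,k). Finally C(t,k)·k! ≤ t^k and k^k ≤ 8^k·k! give
-- C(t,k)·k^(2k) ≤ (8tk)^k ≤ u^(2k) when 3t, 3k ≤ u.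
module Submission where

open import Defs
open import Data.Nat using (ℕ; _*_; _^_; _≤_)
open import Data.Product using (_×_)

open import Data.Nat using (zero; suc; _+_; _<_; z≤n; s≤s; _<?_; _≤?_; _≟_)
open import Data.Nat.Properties
open import Data.Nat.Combinatorics using (_C_; nCk+nC[k+1]≡[n+1]C[k+1])
open import Data.Nat.Base using (_!)
open import Data.Nat.Tactic.RingSolver using (solve-∀)
open import Data.Nat.ListAction using (sum)
open import Data.Nat.ListAction.Properties using (sum-++)
open import Data.Bool using (Bool; true; false; T; if_then_else_)
open import Data.Bool.Properties using (T?)
open import Data.Fin using (Fin; toℕ)
import Data.Fin as Fin
open import Data.Fin.Properties using (toℕ<n; all?)
import Data.Fin.Properties as Fin
open import Data.Product using (_,_; proj₂; ∃-syntax)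
open import Data.Sum using (_⊎_; inj₁; inj₂)
open import Data.Vec using (Vec; []; _∷_; lookup)
open import Data.List using (List; []; _∷_; _++_; map; concatMap; filter; length)
open import Data.List.Properties
  using (filter-++; filter-none; length-++; length-filter; map-++; map-∘; map-cong; ++-identityʳ)
open import Data.List.Relation.Binary.Sublist.Heterogeneous.Properties using (length-mono-≤; ⊆-filter-Sublist)
open import Data.List.Relation.Binary.Sublist.Propositional using (⊆-refl)
import Data.List.Relation.Unary.All as All
open import Function using (_∘_)
open import Relation.Nullary using (Dec; yes; no; ¬_)
open import Relation.Nullary.Decidable using (_×-dec_; _→-dec_)
open import Relation.Unary using (Decidable)
open import Relation.Unary.Properties using (U?)
open import Relation.Binary.PropositionalEquality
open import Data.Empty using (⊥-elim)

module _ {A : Set} {P Q : A → Set} (P? : Decidable P) (Q? : Decidable Q) where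

  length-filter-mono : (∀ {x} → P x → Q x) → ∀ xs →
                       length (filter P? xs) ≤ length (filter Q? xs)
  length-filter-mono P⇒Q xs =
    length-mono-≤ (⊆-filter-Sublist P? Q? (λ { refl → P⇒Q }) (⊆-refl {x = xs}))

module _ {A : Set} {P : A → Set} (P? : Decidable P) where

  length-filter-none : (∀ x → ¬ P x) → ∀ xs → length (filter P? xs) ≡ 0
  length-filter-none ¬P xs = cong length (filter-none P? (All.universal ¬P xs))

  length-filter-++ : ∀ xs ys →
    length (filter P? (xs ++ ys)) ≡ length (filter P? xs) + length (filter P? ys)
  length-filter-++ xs ys = trans (cong length (filter-++ P? xs ys)) (length-++ (filter P? xs))

  length-filter-map : ∀ {B : Set} (g : B → A) ys →
    length (filter P? (map g ys)) ≡ length (filter (P? ∘ g) ys)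
  length-filter-map g [] = refl
  length-filter-map g (y ∷ ys) with P? (g y)
  ... | yes _ = cong suc (length-filter-map g ys)
  ... | no  _ = length-filter-map g ys

  length-filter-concatMap : ∀ {B : Set} (f : B → List A) ys →
    length (filter P? (concatMap f ys)) ≡ sum (map (λ y → length (filter P? (f y))) ys)
  length-filter-concatMap f [] = refl
  length-filter-concatMap f (y ∷ ys) =
    trans (length-filter-++ (f y) (concatMap f ys))
          (cong (length (filter P? (f y)) +_) (length-filter-concatMap f ys))

sum-map-mono : ∀ {A : Set} {f g : A → ℕ} → (∀ x → f x ≤ g x) → ∀ xs →
               sum (map f xs) ≤ sum (map g xs)
sum-map-mono f≤g [] = z≤n
sum-map-mono f≤g (x ∷ xs) = +-mono-≤ (f≤g x) (sum-map-mono f≤g xs)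

sumBelow : ℕ → (ℕ → ℕ) → ℕ
sumBelow zero    f = 0
sumBelow (suc n) f = sumBelow n f + f n

sumBelow-suc : ∀ n f → sumBelow (suc n) f ≡ f 0 + sumBelow n (f ∘ suc)
sumBelow-suc zero    f = +-comm 0 (f 0)
sumBelow-suc (suc n) f =
  trans (cong (_+ f (suc n)) (sumBelow-suc n f)) (+-assoc (f 0) (sumBelow n (f ∘ suc)) (f (suc n)))

sumBelow-zero : ∀ n → sumBelow n (λ _ → 0) ≡ 0
sumBelow-zero zero    = refl
sumBelow-zero (suc n) = trans (+-identityʳ _) (sumBelow-zero n)

sumBelow-mono : ∀ n {f g} → (∀ b → f b ≤ g b) → sumBelow n f ≤ sumBelow n g
sumBelow-mono zero    f≤g = z≤n
sumBelow-mono (suc n) f≤g = +-mono-≤ (sumBelow-mono n f≤g) (f≤g n)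

sumBelow-monoˡ : ∀ f {m n} → m ≤ n → sumBelow m f ≤ sumBelow n f
sumBelow-monoˡ f {m} {zero}  z≤n = ≤-refl
sumBelow-monoˡ f {m} {suc n} m≤1+n with m≤n⇒m<n∨m≡n m≤1+n
... | inj₁ (s≤s m≤n) = ≤-trans (sumBelow-monoˡ f m≤n) (m≤m+n (sumBelow n f) (f n))
... | inj₂ refl      = ≤-refl

sumBelow-*ˡ : ∀ x f n → sumBelow n (λ b → x * f b) ≡ x * sumBelow n f
sumBelow-*ˡ x f zero    = sym (*-zeroʳ x)
sumBelow-*ˡ x f (suc n) =
  trans (cong (_+ x * f n) (sumBelow-*ˡ x f n)) (sym (*-distribˡ-+ x (sumBelow n f) (f n)))

sumBelow-2^ : ∀ t c → sumBelow c (λ b → 2 ^ (t + b)) ≤ 2 ^ (t + c)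
sumBelow-2^ t zero    = z≤n
sumBelow-2^ t (suc c) = begin
  sumBelow c (λ b → 2 ^ (t + b)) + 2 ^ (t + c) ≤⟨ +-monoˡ-≤ (2 ^ (t + c)) (sumBelow-2^ t c) ⟩
  2 ^ (t + c) + 2 ^ (t + c)                    ≡⟨ cong (2 ^ (t + c) +_) (sym (+-identityʳ _)) ⟩
  2 ^ suc (t + c)                              ≡⟨ cong (2 ^_) (sym (+-suc t c)) ⟩
  2 ^ (t + suc c)                              ∎
  where open ≤-Reasoning

hockey-stick : ∀ k c → sumBelow c (λ b → b C k) ≡ c C suc k
hockey-stick k zero    = refl
hockey-stick k (suc c) = begin
  sumBelow c (λ b → b C k) + c C k ≡⟨ cong (_+ c C k) (hockey-stick k c) ⟩
  c C suc k + c C k                ≡⟨ +-comm (c C suc k) (c C k) ⟩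
  c C k + c C suc k                ≡⟨ nCk+nC[k+1]≡[n+1]C[k+1] c k ⟩
  suc c C suc k                    ∎
  where open ≡-Reasoning

below : ℕ → (ℕ → ℕ) → ℕ → ℕ
below c w b with b <? c
... | yes _ = w b
... | no  _ = 0

below-≤ : ∀ c w b → below c w b ≤ w b
below-≤ c w b with b <? c
... | yes _ = ≤-refl
... | no  _ = z≤n

below-< : ∀ {c b} w → b < c → below c w b ≡ w b
below-< {c} {b} w b<c with b <? c
... | yes _   = refl
... | no b≮c = ⊥-elim (b≮c b<c)

below-≮ : ∀ {c b} w → ¬ b < c → below c w b ≡ 0
below-≮ {c} {b} w b≮c with b <? c
... | yes b<c = ⊥-elim (b≮c b<c)
... | no  _   = refl

sumBelow-below : ∀ c w n → sumBelow n (below c w) ≤ sumBelow c w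
sumBelow-below c w zero    = z≤n
sumBelow-below c w (suc n) = split (n <? c)
  where
  split : Dec (n < c) → sumBelow (suc n) (below c w) ≤ sumBelow c w
  split (yes n<c) = ≤-trans (sumBelow-mono (suc n) (below-≤ c w)) (sumBelow-monoˡ w n<c)
  split (no  n≮c) = begin
    sumBelow n (below c w) + below c w n ≡⟨ cong (sumBelow n (below c w) +_) (below-≮ w n≮c) ⟩
    sumBelow n (below c w) + 0           ≡⟨ +-identityʳ _ ⟩
    sumBelow n (below c w)               ≤⟨ sumBelow-below c w n ⟩
    sumBelow c w                         ∎
    where open ≤-Reasoning

sum-map-zero : ∀ {A : Set} (xs : List A) → sum (map (λ _ → 0) xs) ≡ 0
sum-map-zero []       = refl
sum-map-zero (x ∷ xs) = sum-map-zero xs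

rows : (n : ℕ) → List (Vec Bool n)
rows = allVecs (true ∷ false ∷ [])

sum-rows-suc : ∀ n (f : Vec Bool (suc n) → ℕ) →
  sum (map f (rows (suc n))) ≡
  sum (map (f ∘ (true ∷_)) (rows n)) + sum (map (f ∘ (false ∷_)) (rows n))
sum-rows-suc n f = begin
  sum (map f (map (true ∷_) L ++ (map (false ∷_) L ++ [])))
    ≡⟨ cong (λ xs → sum (map f (map (true ∷_) L ++ xs))) (++-identityʳ _) ⟩
  sum (map f (map (true ∷_) L ++ map (false ∷_) L))
    ≡⟨ cong sum (map-++ f (map (true ∷_) L) _) ⟩
  sum (map f (map (true ∷_) L) ++ map f (map (false ∷_) L))
    ≡⟨ sum-++ (map f (map (true ∷_) L)) _ ⟩
  sum (map f (map (true ∷_) L)) + sum (map f (map (false ∷_) L))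
    ≡⟨ sym (cong₂ (λ xs ys → sum xs + sum ys) (map-∘ L) (map-∘ L)) ⟩
  sum (map (f ∘ (true ∷_)) L) + sum (map (f ∘ (false ∷_)) L) ∎
  where
  open ≡-Reasoning
  L = rows n

isEmptyRow : ∀ {n} → Vec Bool n → Bool
isEmptyRow []          = true
isEmptyRow (true ∷ r)  = false
isEmptyRow (false ∷ r) = isEmptyRow r

-- e for the empty row, w b for the row whose only entry is in column b, 0 otherwise
rowBound : ∀ {n} → ℕ → (ℕ → ℕ) → Vec Bool n → ℕ
rowBound e w []          = e
rowBound e w (true ∷ r)  = if isEmptyRow r then w 0 else 0
rowBound e w (false ∷ r) = rowBound e (w ∘ suc) r

sum-rows-isEmptyRow : ∀ n x → sum (map (λ r → if isEmptyRow r then x else 0) (rows n)) ≡ x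
sum-rows-isEmptyRow zero    x = +-identityʳ x
sum-rows-isEmptyRow (suc n) x = begin
  sum (map g (rows (suc n)))
    ≡⟨ sum-rows-suc n g ⟩
  sum (map (λ _ → 0) (rows n)) + sum (map g (rows n))
    ≡⟨ cong₂ _+_ (sum-map-zero (rows n)) (sum-rows-isEmptyRow n x) ⟩
  x ∎
  where
  open ≡-Reasoning
  g : ∀ {m} → Vec Bool m → ℕ
  g r = if isEmptyRow r then x else 0

sum-rows-rowBound : ∀ n e w → sum (map (rowBound e w) (rows n)) ≡ e + sumBelow n w
sum-rows-rowBound zero    e w = refl
sum-rows-rowBound (suc n) e w = begin
  sum (map (rowBound e w) (rows (suc n)))
    ≡⟨ sum-rows-suc n (rowBound e w) ⟩
  sum (map (λ r → if isEmptyRow r then w 0 else 0) (rows n)) + sum (map (rowBound e (w ∘ suc)) (rows n))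
    ≡⟨ cong₂ _+_ (sum-rows-isEmptyRow n (w 0)) (sum-rows-rowBound n e (w ∘ suc)) ⟩
  w 0 + (e + sumBelow n (w ∘ suc))
    ≡⟨ x∙yz≈y∙xz (w 0) e _ ⟩
  e + (w 0 + sumBelow n (w ∘ suc))
    ≡⟨ cong (e +_) (sym (sumBelow-suc n w)) ⟩
  e + sumBelow (suc n) w ∎
  where
  open ≡-Reasoning
  open import Algebra.Properties.CommutativeSemigroup +-commutativeSemigroup using (x∙yz≈y∙xz)

data RowShape {n} (e : ℕ) (w : ℕ → ℕ) (r : Vec Bool n) : Set where
  empty    : countRow r ≡ 0 → rowBound e w r ≡ e → isEmptyRow r ≡ true → RowShape e w r
  single   : (b : Fin n) → T (lookup r b) → countRow r ≡ 1 → rowBound e w r ≡ w (toℕ b) →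
             isEmptyRow r ≡ false → RowShape e w r
  multiple : (b b′ : Fin n) → b ≢ b′ → T (lookup r b) → T (lookup r b′) →
             isEmptyRow r ≡ false → RowShape e w r

rowShape : ∀ {n} e w (r : Vec Bool n) → RowShape e w r
rowShape e w [] = empty refl refl refl
rowShape e w (true ∷ r) with rowShape e (w ∘ suc) r
... | empty #r≡0 _ r-empty =
  single Fin.zero _ (cong suc #r≡0) (cong (λ z → if z then w 0 else 0) r-empty) refl
... | single b rb _ _ _ = multiple Fin.zero (Fin.suc b) (λ ()) _ rb refl
... | multiple b b′ b≢b′ rb rb′ _ =
  multiple (Fin.suc b) (Fin.suc b′) (b≢b′ ∘ Fin.suc-injective) rb rb′ refl
rowShape e w (false ∷ r) with rowShape e (w ∘ suc) r
... | empty #r≡0 bound r-empty = empty #r≡0 bound r-empty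
... | single b rb #r≡1 bound r-nonempty = single (Fin.suc b) rb #r≡1 bound r-nonempty
... | multiple b b′ b≢b′ rb rb′ r-nonempty =
  multiple (Fin.suc b) (Fin.suc b′) (b≢b′ ∘ Fin.suc-injective) rb rb′ r-nonempty

ColumnsBelow : ∀ {t₁ t₂} → ℕ → PSubset t₁ t₂ → Set
ColumnsBelow c S = ∀ a b → (a , b) ∈ₚ S → toℕ b < c

columnsBelow? : ∀ {t₁ t₂} c (S : PSubset t₁ t₂) → Dec (ColumnsBelow c S)
columnsBelow? c S = all? λ a → all? λ b → T? (lookup (lookup S a) b) →-dec (toℕ b <? c)

-- [t] × [c] is represented inside [t] × [t₂] by restricting the columns, so that
-- all the counts below range over the same enumeration allPSubsets t t₂.
AntichainBelow : ∀ {t₁ t₂} → ℕ → (ℕ → Set) → PSubset t₁ t₂ → Set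
AntichainBelow c Z S = IsAntichain S × ColumnsBelow c S × Z (size S)

antichainBelow? : ∀ {t₁ t₂} c {Z : ℕ → Set} → Decidable Z → Decidable (AntichainBelow {t₁} {t₂} c Z)
antichainBelow? c Z? S = isAntichain? S ×-dec columnsBelow? c S ×-dec Z? (size S)

#antichainsBelow : ∀ {Z : ℕ → Set} (t t₂ c : ℕ) → Decidable Z → ℕ
#antichainsBelow t t₂ c Z? = length (filter (antichainBelow? c Z?) (allPSubsets t t₂))

module _ {t t₂ : ℕ} {r : Vec Bool t₂} {S : PSubset t t₂} where

  isAntichain-tail : IsAntichain (r ∷ S) → IsAntichain S
  isAntichain-tail A (a , b) (a′ , b′) p∈S q∈S (a≤a′ , b≤b′)
    with refl ← A (Fin.suc a , b) (Fin.suc a′ , b′) p∈S q∈S (s≤s a≤a′ , b≤b′) = refl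

  columnsBelow-tail : ∀ {c} → ColumnsBelow c (r ∷ S) → ColumnsBelow c S
  columnsBelow-tail below a = below (Fin.suc a)

  isAntichain-head-unique : ∀ {b b′} → IsAntichain (r ∷ S) →
    T (lookup r b) → T (lookup r b′) → b ≡ b′
  isAntichain-head-unique {b} {b′} A rb rb′ with ≤-total (toℕ b) (toℕ b′)
  ... | inj₁ b≤b′ = cong proj₂ (A (Fin.zero , b) (Fin.zero , b′) rb rb′ (z≤n , b≤b′))
  ... | inj₂ b′≤b = sym (cong proj₂ (A (Fin.zero , b′) (Fin.zero , b) rb′ rb (z≤n , b′≤b)))

  isAntichain-columnsBelow-head : ∀ {b} → IsAntichain (r ∷ S) → T (lookup r b) →
    ColumnsBelow (toℕ b) S
  isAntichain-columnsBelow-head {b} A rb a b′ b′∈S with toℕ b ≤? toℕ b′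
  ... | no  b≰b′ = ≰⇒> b≰b′
  ... | yes b≤b′ with () ← A (Fin.zero , b) (Fin.suc a , b′) rb b′∈S (z≤n , b≤b′)

#antichainsBelow-suc : ∀ t t₂ c {Z : ℕ → Set} (Z? : Decidable Z) e w →
  #antichainsBelow t t₂ c Z? ≤ e →
  (∀ b → b < c → #antichainsBelow t t₂ b (Z? ∘ suc) ≤ w b) →
  #antichainsBelow (suc t) t₂ c Z? ≤ e + sumBelow c w
#antichainsBelow-suc t t₂ c {Z} Z? e w #≤e #≤w = begin
  length (filter P? (concatMap (λ r → map (r ∷_) L) (rows t₂)))
    ≡⟨ length-filter-concatMap P? (λ r → map (r ∷_) L) (rows t₂) ⟩
  sum (map (λ r → length (filter P? (map (r ∷_) L))) (rows t₂))
    ≡⟨ cong sum (map-cong (λ r → length-filter-map P? (r ∷_) L) (rows t₂)) ⟩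
  sum (map (λ r → length (filter (P? ∘ (r ∷_)) L)) (rows t₂))
    ≤⟨ sum-map-mono with-first-row (rows t₂) ⟩
  sum (map (rowBound e (below c w)) (rows t₂))
    ≡⟨ sum-rows-rowBound t₂ e (below c w) ⟩
  e + sumBelow t₂ (below c w)
    ≤⟨ +-monoʳ-≤ e (sumBelow-below c w t₂) ⟩
  e + sumBelow c w ∎
  where
  open ≤-Reasoning
  L = allPSubsets t t₂
  P? = antichainBelow? {suc t} {t₂} c Z?

  impossible : ∀ {r} → (∀ {S} → ¬ AntichainBelow c Z (r ∷ S)) →
               length (filter (P? ∘ (r ∷_)) L) ≤ rowBound e (below c w) r
  impossible {r} ¬P = ≤-trans (≤-reflexive (length-filter-none (P? ∘ (r ∷_)) (λ _ → ¬P) L)) z≤n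

  with-first-row : ∀ r → length (filter (P? ∘ (r ∷_)) L) ≤ rowBound e (below c w) r
  with-first-row r with rowShape e (below c w) r
  ... | empty #r≡0 bound _ = begin
    length (filter (P? ∘ (r ∷_)) L)
      ≤⟨ length-filter-mono (P? ∘ (r ∷_)) (antichainBelow? c Z?)
           (λ (A , below , z) → isAntichain-tail A , columnsBelow-tail below ,
                                subst Z (cong (_+ _) #r≡0) z) L ⟩
    #antichainsBelow t t₂ c Z? ≤⟨ #≤e ⟩
    e                          ≡⟨ sym bound ⟩
    rowBound e (below c w) r   ∎
  ... | multiple b b′ b≢b′ rb rb′ _ =
    impossible (λ (A , _) → b≢b′ (isAntichain-head-unique A rb rb′))
  ... | single b rb #r≡1 bound _ = single-in-column (toℕ b <? c)
    where
    single-in-column : Dec (toℕ b < c) →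
                       length (filter (P? ∘ (r ∷_)) L) ≤ rowBound e (below c w) r
    single-in-column (yes b<c) = begin
      length (filter (P? ∘ (r ∷_)) L)
        ≤⟨ length-filter-mono (P? ∘ (r ∷_)) (antichainBelow? (toℕ b) (Z? ∘ suc))
             (λ (A , _ , z) → isAntichain-tail A , isAntichain-columnsBelow-head A rb ,
                              subst Z (cong (_+ _) #r≡1) z) L ⟩
      #antichainsBelow t t₂ (toℕ b) (Z? ∘ suc) ≤⟨ #≤w (toℕ b) b<c ⟩
      w (toℕ b)                                ≡⟨ sym (below-< w b<c) ⟩
      below c w (toℕ b)                        ≡⟨ sym bound ⟩
      rowBound e (below c w) r                 ∎
    single-in-column (no b≮c) = impossible (λ (_ , below , _) → b≮c (below Fin.zero b rb))

#antichainsBelow≤2^[t+c] : ∀ t t₂ c → #antichainsBelow t t₂ c U? ≤ 2 ^ (t + c)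
#antichainsBelow≤2^[t+c] zero    t₂ c =
  ≤-trans (length-filter (antichainBelow? c U?) (allPSubsets 0 t₂)) (m^n>0 2 c)
#antichainsBelow≤2^[t+c] (suc t) t₂ c = begin
  #antichainsBelow (suc t) t₂ c U?
    ≤⟨ #antichainsBelow-suc t t₂ c U? _ _ (#antichainsBelow≤2^[t+c] t t₂ c)
         (λ b _ → #antichainsBelow≤2^[t+c] t t₂ b) ⟩
  2 ^ (t + c) + sumBelow c (λ b → 2 ^ (t + b))
    ≤⟨ +-monoʳ-≤ (2 ^ (t + c)) (sumBelow-2^ t c) ⟩
  2 ^ (t + c) + 2 ^ (t + c)
    ≡⟨ cong (2 ^ (t + c) +_) (sym (+-identityʳ _)) ⟩
  2 ^ (suc t + c) ∎
  where open ≤-Reasoning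

#antichainsBelow-ofSize≤ : ∀ t t₂ c k → #antichainsBelow t t₂ c (_≟ k) ≤ (t C k) * (c C k)
#antichainsBelow-ofSize≤ zero    t₂ c zero    =
  length-filter (antichainBelow? c (_≟ 0)) (allPSubsets 0 t₂)
#antichainsBelow-ofSize≤ zero    t₂ c (suc k) = ≤-reflexive
  (length-filter-none (antichainBelow? c (_≟ suc k)) (λ { [] (_ , _ , ()) }) (allPSubsets 0 t₂))
#antichainsBelow-ofSize≤ (suc t) t₂ c zero    = begin
  #antichainsBelow (suc t) t₂ c (_≟ 0)
    ≤⟨ #antichainsBelow-suc t t₂ c (_≟ 0) 1 (λ _ → 0) (#antichainsBelow-ofSize≤ t t₂ c 0) none ⟩
  1 + sumBelow c (λ _ → 0) ≡⟨ cong suc (sumBelow-zero c) ⟩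
  1                        ∎
  where
  open ≤-Reasoning
  none : ∀ b → b < c → #antichainsBelow t t₂ b (λ s → suc s ≟ 0) ≤ 0
  none b _ = ≤-reflexive
    (length-filter-none (antichainBelow? b (λ s → suc s ≟ 0)) (λ { _ (_ , _ , ()) }) (allPSubsets t t₂))
#antichainsBelow-ofSize≤ (suc t) t₂ c (suc k) = begin
  #antichainsBelow (suc t) t₂ c (_≟ suc k)
    ≤⟨ #antichainsBelow-suc t t₂ c (_≟ suc k) _ (λ b → (t C k) * (b C k))
         (#antichainsBelow-ofSize≤ t t₂ c (suc k)) one-smaller ⟩
  (t C suc k) * (c C suc k) + sumBelow c (λ b → (t C k) * (b C k))
    ≡⟨ cong ((t C suc k) * (c C suc k) +_) (trans (sumBelow-*ˡ (t C k) (_C k) c)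
                                                  (cong ((t C k) *_) (hockey-stick k c))) ⟩
  (t C suc k) * (c C suc k) + (t C k) * (c C suc k)
    ≡⟨ sym (*-distribʳ-+ (c C suc k) (t C suc k) (t C k)) ⟩
  ((t C suc k) + (t C k)) * (c C suc k)
    ≡⟨ cong (_* (c C suc k)) (trans (+-comm (t C suc k) (t C k)) (nCk+nC[k+1]≡[n+1]C[k+1] t k)) ⟩
  (suc t C suc k) * (c C suc k) ∎
  where
  open ≤-Reasoning
  one-smaller : ∀ b → b < c → #antichainsBelow t t₂ b (λ s → suc s ≟ suc k) ≤ (t C k) * (b C k)
  one-smaller b _ = begin
    #antichainsBelow t t₂ b (λ s → suc s ≟ suc k)
      ≤⟨ length-filter-mono (antichainBelow? b (λ s → suc s ≟ suc k)) (antichainBelow? b (_≟ k))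
           (λ (A , below , 1+s≡1+k) → A , below , suc-injective 1+s≡1+k) (allPSubsets t t₂) ⟩
    #antichainsBelow t t₂ b (_≟ k)
      ≤⟨ #antichainsBelow-ofSize≤ t t₂ b k ⟩
    (t C k) * (b C k) ∎

bernoulli : ∀ n k → n ^ suc k + suc k * n ^ k ≤ suc n ^ suc k
bernoulli n zero    = ≤-reflexive (+-comm (n * 1) 1)
bernoulli n (suc k) = begin
  n * n ^ suc k + suc (suc k) * n ^ suc k                  ≤⟨ m≤m+n _ (suc k * n ^ k) ⟩
  n * n ^ suc k + suc (suc k) * n ^ suc k + suc k * n ^ k  ≡⟨ expand n (n ^ k) k ⟩
  suc n * (n ^ suc k + suc k * n ^ k)                      ≤⟨ *-monoʳ-≤ (suc n) (bernoulli n k) ⟩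
  suc n * suc n ^ suc k                                    ∎
  where
  open ≤-Reasoning
  expand : ∀ n x k → n * (n * x) + suc (suc k) * (n * x) + suc k * x ≡ suc n * (n * x + suc k * x)
  expand = solve-∀

nCk*k!≤n^k : ∀ n k → (n C k) * k ! ≤ n ^ k
nCk*k!≤n^k n       zero    = ≤-refl
nCk*k!≤n^k zero    (suc k) = z≤n
nCk*k!≤n^k (suc n) (suc k) = begin
  (suc n C suc k) * (suc k * k !)
    ≡⟨ cong (_* (suc k * k !)) (sym (nCk+nC[k+1]≡[n+1]C[k+1] n k)) ⟩
  ((n C k) + (n C suc k)) * (suc k * k !)
    ≡⟨ regroup (n C k) (n C suc k) k (k !) ⟩
  suc k * ((n C k) * k !) + (n C suc k) * suc k !
    ≤⟨ +-mono-≤ (*-monoʳ-≤ (suc k) (nCk*k!≤n^k n k)) (nCk*k!≤n^k n (suc k)) ⟩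
  suc k * n ^ k + n ^ suc k
    ≡⟨ +-comm (suc k * n ^ k) _ ⟩
  n ^ suc k + suc k * n ^ k
    ≤⟨ bernoulli n k ⟩
  suc n ^ suc k ∎
  where
  open ≤-Reasoning
  regroup : ∀ x y k f → (x + y) * (suc k * f) ≡ suc k * (x * f) + y * (suc k * f)
  regroup = solve-∀

-- (1 + 1/N)^m ≤ N/r for N = m + r, cleared of denominators
[m+r+1]^m*r≤[m+r]^[1+m] : ∀ m r → suc (m + r) ^ m * r ≤ (m + r) ^ suc m
[m+r+1]^m*r≤[m+r]^[1+m] zero    r = ≤-reflexive (*-comm 1 r)
[m+r+1]^m*r≤[m+r]^[1+m] (suc m) r =
  *-cancelʳ-≤ (suc N ^ suc m * r) (N ^ suc (suc m)) (suc r) (begin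
    (suc N * suc N ^ m * r) * suc r   ≡⟨ regroup (suc N) (suc N ^ m) r ⟩
    (suc N ^ m * suc r) * (suc N * r) ≤⟨ *-mono-≤ ih step ⟩
    N ^ suc m * (N * suc r)           ≡⟨ regroup′ (N ^ suc m) N r ⟩
    N ^ suc (suc m) * suc r           ∎)
  where
  open ≤-Reasoning
  N = suc (m + r)
  ih : suc N ^ m * suc r ≤ N ^ suc m
  ih = subst (λ n → suc n ^ m * suc r ≤ n ^ suc m) (+-suc m r) ([m+r+1]^m*r≤[m+r]^[1+m] m (suc r))
  step : suc N * r ≤ N * suc r
  step = begin
    r + N * r ≤⟨ +-monoˡ-≤ (N * r) (≤-trans (m≤n+m r m) (n≤1+n _)) ⟩
    N + N * r ≡⟨ sym (*-suc N r) ⟩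
    N * suc r ∎
  regroup : ∀ a b r → (a * b * r) * suc r ≡ (b * suc r) * (a * r)
  regroup = solve-∀
  regroup′ : ∀ x n r → x * (n * suc r) ≡ (n * x) * suc r
  regroup′ = solve-∀

[m+r+1]^m≤2*[m+r]^m : ∀ {m r} → m ≤ r → suc (m + r) ^ m ≤ 2 * (m + r) ^ m
[m+r+1]^m≤2*[m+r]^m {zero}  {zero}  _   = s≤s z≤n
[m+r+1]^m≤2*[m+r]^m {m}     {suc r} m≤r =
  *-cancelʳ-≤ (suc N ^ m) (2 * N ^ m) (suc r) (begin
    suc N ^ m * suc r       ≤⟨ [m+r+1]^m*r≤[m+r]^[1+m] m (suc r) ⟩
    N * N ^ m               ≤⟨ *-monoˡ-≤ (N ^ m) (+-monoˡ-≤ (suc r) m≤r) ⟩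
    (suc r + suc r) * N ^ m ≡⟨ regroup (suc r) (N ^ m) ⟩
    2 * N ^ m * suc r       ∎)
  where
  open ≤-Reasoning
  N = m + suc r
  regroup : ∀ a x → (a + a) * x ≡ 2 * x * a
  regroup = solve-∀

^-distribʳ-* : ∀ m n k → (m * n) ^ k ≡ m ^ k * n ^ k
^-distribʳ-* m n zero    = refl
^-distribʳ-* m n (suc k) =
  trans (cong (m * n *_) (^-distribʳ-* m n k)) (regroup m n (m ^ k) (n ^ k))
  where
  regroup : ∀ a b x y → a * b * (x * y) ≡ a * x * (b * y)
  regroup = solve-∀

even-or-odd : ∀ k → (∃[ m ] k ≡ m + m) ⊎ (∃[ m ] k ≡ suc (m + m))
even-or-odd zero = inj₁ (0 , refl)
even-or-odd (suc k) with even-or-odd k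
... | inj₁ (m , k≡m+m)   = inj₂ (m , cong suc k≡m+m)
... | inj₂ (m , k≡1+m+m) = inj₁ (suc m , trans (cong suc k≡1+m+m) (cong suc (sym (+-suc m m))))

-- (1 + 1/k)^k ≤ 8: split the exponent into two halves, each bounded by 2
[1+k]^k≤8*k^k : ∀ k → suc k ^ k ≤ 8 * k ^ k
[1+k]^k≤8*k^k k with even-or-odd k
... | inj₁ (m , refl) = begin
  suc K ^ (m + m)           ≡⟨ ^-distribˡ-+-* (suc K) m m ⟩
  suc K ^ m * suc K ^ m     ≤⟨ *-mono-≤ half half ⟩
  (2 * K ^ m) * (2 * K ^ m) ≡⟨ regroup (K ^ m) ⟩
  4 * (K ^ m * K ^ m)       ≡⟨ cong (4 *_) (sym (^-distribˡ-+-* K m m)) ⟩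
  4 * K ^ (m + m)           ≤⟨ *-monoˡ-≤ (K ^ (m + m)) (m≤m+n 4 4) ⟩
  8 * K ^ (m + m)           ∎
  where
  open ≤-Reasoning
  K = m + m
  half : suc K ^ m ≤ 2 * K ^ m
  half = [m+r+1]^m≤2*[m+r]^m {m} {m} ≤-refl
  regroup : ∀ x → (2 * x) * (2 * x) ≡ 4 * (x * x)
  regroup = solve-∀
... | inj₂ (m , refl) = begin
  suc K * suc K ^ (m + m)
    ≡⟨ cong (suc K *_) (^-distribˡ-+-* (suc K) m m) ⟩
  suc K * (suc K ^ m * suc K ^ m)
    ≤⟨ *-mono-≤ (+-monoˡ-≤ K {1} {K} (s≤s z≤n)) (*-mono-≤ half half) ⟩
  (K + K) * ((2 * K ^ m) * (2 * K ^ m))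
    ≡⟨ regroup K (K ^ m) ⟩
  8 * (K * (K ^ m * K ^ m))
    ≡⟨ cong (λ x → 8 * (K * x)) (sym (^-distribˡ-+-* K m m)) ⟩
  8 * K ^ K ∎
  where
  open ≤-Reasoning
  K = suc (m + m)
  half : suc K ^ m ≤ 2 * K ^ m
  half = subst (λ n → suc n ^ m ≤ 2 * n ^ m) (+-suc m m) ([m+r+1]^m≤2*[m+r]^m (n≤1+n m))
  regroup : ∀ k x → (k + k) * ((2 * x) * (2 * x)) ≡ 8 * (k * (x * x))
  regroup = solve-∀

k^k≤8^k*k! : ∀ k → k ^ k ≤ 8 ^ k * k !
k^k≤8^k*k! zero    = ≤-refl
k^k≤8^k*k! (suc k) = begin
  suc k * suc k ^ k           ≤⟨ *-monoʳ-≤ (suc k) ([1+k]^k≤8*k^k k) ⟩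
  suc k * (8 * k ^ k)         ≤⟨ *-monoʳ-≤ (suc k) (*-monoʳ-≤ 8 (k^k≤8^k*k! k)) ⟩
  suc k * (8 * (8 ^ k * k !)) ≡⟨ regroup (suc k) (8 ^ k) (k !) ⟩
  (8 * 8 ^ k) * (suc k * k !) ∎
  where
  open ≤-Reasoning
  regroup : ∀ a b c → a * (8 * (b * c)) ≡ (8 * b) * (a * c)
  regroup = solve-∀

x^[2n]≡x^n*x^n : ∀ x n → x ^ (2 * n) ≡ x ^ n * x ^ n
x^[2n]≡x^n*x^n x n = trans (cong (λ m → x ^ (n + m)) (+-identityʳ n)) (^-distribˡ-+-* x n n)

nCk*k^[2k]≤u^[2k] : ∀ n k u → 3 * n ≤ u → 3 * k ≤ u → (n C k) * k ^ (2 * k) ≤ u ^ (2 * k)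
nCk*k^[2k]≤u^[2k] n k u 3n≤u 3k≤u = begin
  (n C k) * k ^ (2 * k)             ≡⟨ cong ((n C k) *_) (x^[2n]≡x^n*x^n k k) ⟩
  (n C k) * (k ^ k * k ^ k)         ≤⟨ *-monoʳ-≤ (n C k) (*-monoˡ-≤ (k ^ k) (k^k≤8^k*k! k)) ⟩
  (n C k) * ((8 ^ k * k !) * k ^ k) ≡⟨ regroup (n C k) (8 ^ k) (k !) (k ^ k) ⟩
  ((n C k) * k !) * (8 ^ k * k ^ k) ≤⟨ *-monoˡ-≤ (8 ^ k * k ^ k) (nCk*k!≤n^k n k) ⟩
  n ^ k * (8 ^ k * k ^ k)           ≡⟨ sym (trans (^-distribʳ-* n (8 * k) k)
                                                  (cong (n ^ k *_) (^-distribʳ-* 8 k k))) ⟩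
  (n * (8 * k)) ^ k                 ≤⟨ ^-monoˡ-≤ k n*8k≤u*u ⟩
  (u * u) ^ k                       ≡⟨ ^-distribʳ-* u u k ⟩
  u ^ k * u ^ k                     ≡⟨ sym (x^[2n]≡x^n*x^n u k) ⟩
  u ^ (2 * k)                       ∎
  where
  open ≤-Reasoning
  regroup : ∀ c a f b → c * ((a * f) * b) ≡ (c * f) * (a * b)
  regroup = solve-∀
  n*9k≡3n*3k : ∀ n k → n * (9 * k) ≡ (3 * n) * (3 * k)
  n*9k≡3n*3k = solve-∀
  n*8k≤u*u : n * (8 * k) ≤ u * u
  n*8k≤u*u = begin
    n * (8 * k)       ≤⟨ *-monoʳ-≤ n (*-monoˡ-≤ k (n≤1+n 8)) ⟩
    n * (9 * k)       ≡⟨ n*9k≡3n*3k n k ⟩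
    (3 * n) * (3 * k) ≤⟨ *-mono-≤ 3n≤u 3k≤u ⟩
    u * u             ∎

numAntichains≤4^u : ∀ t₁ t₂ u → 3 * t₁ ≤ u → 3 * t₂ ≤ u → numAntichains t₁ t₂ ≤ 4 ^ u
numAntichains≤4^u t₁ t₂ u 3t₁≤u 3t₂≤u = begin
  numAntichains t₁ t₂
    ≤⟨ length-filter-mono isAntichain? (antichainBelow? t₂ U?)
         (λ A → A , (λ _ b _ → toℕ<n b) , _) (allPSubsets t₁ t₂) ⟩
  #antichainsBelow t₁ t₂ t₂ U?
    ≤⟨ #antichainsBelow≤2^[t+c] t₁ t₂ t₂ ⟩
  2 ^ (t₁ + t₂)
    ≤⟨ ^-monoʳ-≤ 2 (+-mono-≤ (≤-of-3* t₁ 3t₁≤u) (≤-trans (≤-of-3* t₂ 3t₂≤u) (m≤m+n u 0))) ⟩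
  2 ^ (2 * u)
    ≡⟨ sym (^-*-assoc 2 2 u) ⟩
  4 ^ u ∎
  where
  open ≤-Reasoning
  ≤-of-3* : ∀ t → 3 * t ≤ u → t ≤ u
  ≤-of-3* t = ≤-trans (m≤m+n t _)

numAntichainsOfSize≤ : ∀ t₁ t₂ u → 3 * t₁ ≤ u → 3 * t₂ ≤ u → ∀ k → 3 * k ≤ u →
  numAntichainsOfSize t₁ t₂ k * k ^ (4 * k) ≤ u ^ (4 * k)
numAntichainsOfSize≤ t₁ t₂ u 3t₁≤u 3t₂≤u k 3k≤u = begin
  numAntichainsOfSize t₁ t₂ k * k ^ (4 * k)
    ≤⟨ *-monoˡ-≤ (k ^ (4 * k)) #size≤ ⟩
  ((t₁ C k) * (t₂ C k)) * k ^ (4 * k)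
    ≡⟨ cong ((t₁ C k) * (t₂ C k) *_) (x^[4k]≡x^[2k]*x^[2k] k) ⟩
  ((t₁ C k) * (t₂ C k)) * (k ^ (2 * k) * k ^ (2 * k))
    ≡⟨ *-interchange (t₁ C k) (t₂ C k) (k ^ (2 * k)) (k ^ (2 * k)) ⟩
  ((t₁ C k) * k ^ (2 * k)) * ((t₂ C k) * k ^ (2 * k))
    ≤⟨ *-mono-≤ (nCk*k^[2k]≤u^[2k] t₁ k u 3t₁≤u 3k≤u) (nCk*k^[2k]≤u^[2k] t₂ k u 3t₂≤u 3k≤u) ⟩
  u ^ (2 * k) * u ^ (2 * k)
    ≡⟨ sym (x^[4k]≡x^[2k]*x^[2k] u) ⟩
  u ^ (4 * k) ∎
  where
  open ≤-Reasoning
  open import Algebra.Properties.CommutativeSemigroup *-commutativeSemigroup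
    using () renaming (interchange to *-interchange)
  x^[4k]≡x^[2k]*x^[2k] : ∀ x → x ^ (4 * k) ≡ x ^ (2 * k) * x ^ (2 * k)
  x^[4k]≡x^[2k]*x^[2k] x = trans (cong (x ^_) (*-assoc 2 2 k)) (x^[2n]≡x^n*x^n x (2 * k))
  #size≤ : numAntichainsOfSize t₁ t₂ k ≤ (t₁ C k) * (t₂ C k)
  #size≤ = ≤-trans (length-filter-mono _ (antichainBelow? t₂ (_≟ k))
                      (λ (A , #≡k) → A , (λ _ b _ → toℕ<n b) , #≡k) (allPSubsets t₁ t₂))
                   (#antichainsBelow-ofSize≤ t₁ t₂ t₂ k)

lemma2p7 : (t₁ t₂ u : ℕ) → 1 ≤ t₁ → 1 ≤ t₂ → 1 ≤ u → 3 * t₁ ≤ u → 3 * t₂ ≤ u →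
    (numAntichains t₁ t₂ ≤ 4 ^ u)
    × ((k : ℕ) → 3 * k ≤ u →
         numAntichainsOfSize t₁ t₂ k * k ^ (4 * k) ≤ u ^ (4 * k))
lemma2p7 t₁ t₂ u _ _ _ 3t₁≤u 3t₂≤u =
  numAntichains≤4^u t₁ t₂ u 3t₁≤u 3t₂≤u , numAntichainsOfSize≤ t₁ t₂ u 3t₁≤u 3t₂≤u
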